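{- Let $n\ge 4$ be an integer. The Harary graph $H_{3,n}$ is distance magic if and only if $n=5$.
   Context: All graphs are finite and simple. A distance magic labeling of a graph $G$ on $N$ vertices is a bijection $f:V(G)\to\{1,\dots,N\}$ such that the weight $w_G(u)=\sum_{v\in N_G(u)}f(v)$ is the same constant for every vertex $u$; $G$ is distance magic if it has such a labeling. Harary graph $H_{m,n}$ ($1\le m<n$), with vertices $v_0,\dots,v_{n-1}$ (indices mod $n$): if $m$ is even, $v_i\sim v_j$ iff $j\ne i$ and $j\in\{i-\frac m2,\dots,i+\frac m2\}$ mod $n$; if $m$ is odd and $n$ even, take $H_{m-1,n}$ and add edges $v_iv_{i+n/2}$ for $1\le i\le n/2$; if $m$ and $n$ are odd, take $H_{m-1,n}$ and add edges $v_0v_{(n-1)/2}$, $v_0v_{(n+1)/2}$ and $v_iv_{i+(n+1)/2}$ for $1\le i<\frac{n-1}{2}$. -}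

module Defs where

open import Data.Nat using (ℕ; zero; suc; _+_; _∸_; _≤_; _<_; _⊔_; _⊓_)
open import Data.Nat.Properties using (_≟_; _≤?_; _<?_)
open import Data.Nat.DivMod using (_/_; _%_)
open import Data.Bool using (Bool; true; false; _∧_; _∨_; not; if_then_else_)
open import Data.Fin using (Fin; toℕ)
open import Data.List using (List; map; allFin)
open import Data.Nat.ListAction using (sum)
open import Data.Product using (Σ; ∃)
open import Function.Bundles using (_⤖_; Bijection)
open import Relation.Binary.PropositionalEquality using (_≡_)
open import Relation.Nullary.Decidable using (⌊_⌋)

AdjRel : ℕ → Set
AdjRel n = Fin n → Fin n → Bool

weight : ∀ {n} → AdjRel n → (Fin n → ℕ) → Fin n → ℕ
weight {n} adj ℓ u =
  sum (map (λ v → if adj u v then ℓ v else 0) (allFin n))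

-- distance magic: a bijection f : V → {1,…,n} (encoded as v ↦ 1 + toℕ (σ v)
-- for a bijection σ : Fin n ⤖ Fin n) whose weight is constant.
DistanceMagic : ∀ {n} → AdjRel n → Set
DistanceMagic {n} adj =
  Σ (Fin n ⤖ Fin n) λ σ →
    ∃ λ k → ∀ u → weight adj (λ v → suc (toℕ (Bijection.to σ v))) u ≡ k

∣_-_∣ : ℕ → ℕ → ℕ
∣ i - j ∣ = (i ∸ j) ⊔ (j ∸ i)

cdist : ℕ → ℕ → ℕ → ℕ
cdist n i j = ∣ i - j ∣ ⊓ (n ∸ ∣ i - j ∣)

eqᵇ : ℕ → ℕ → Bool
eqᵇ a b = ⌊ a ≟ b ⌋

leᵇ : ℕ → ℕ → Bool
leᵇ a b = ⌊ a ≤? b ⌋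

ltᵇ : ℕ → ℕ → Bool
ltᵇ a b = ⌊ a <? b ⌋

isEven : ℕ → Bool
isEven k = eqᵇ (k % 2) 0

evenAdj : ℕ → ℕ → ℕ → ℕ → Bool
evenAdj m n i j = not (eqᵇ i j) ∧ leᵇ (cdist n i j) (m / 2)

-- extra edges for m odd, n even: v_i v_{i+n/2}, 1 ≤ i ≤ n/2 (indices mod n)
-- reduction mod n for 0 ≤ k < 2n (all uses below are in this range)
modN : ℕ → ℕ → ℕ
modN n k = if ltᵇ k n then k else k ∸ n

oddEvenExtra : ℕ → ℕ → ℕ → Bool
oddEvenExtra n i j =
  leᵇ 1 i ∧ leᵇ i (n / 2) ∧ eqᵇ j (modN n (i + n / 2))

oddOddExtra : ℕ → ℕ → ℕ → Bool
oddOddExtra n i j =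
  (eqᵇ i 0 ∧ (eqᵇ j (modN n ((n ∸ 1) / 2)) ∨ eqᵇ j (modN n ((n + 1) / 2))))
  ∨ (leᵇ 1 i ∧ ltᵇ i ((n ∸ 1) / 2) ∧ eqᵇ j (modN n (i + (n + 1) / 2)))

hararyAdjℕ : ℕ → ℕ → ℕ → ℕ → Bool
hararyAdjℕ m n i j with isEven m | isEven n
... | true  | _     = evenAdj m n i j
... | false | true  = not (eqᵇ i j) ∧
                      (evenAdj (m ∸ 1) n i j ∨ oddEvenExtra n i j ∨ oddEvenExtra n j i)
... | false | false = not (eqᵇ i j) ∧
                      (evenAdj (m ∸ 1) n i j ∨ oddOddExtra n i j ∨ oddOddExtra n j i)


-- the Harary graph H_{m,n} on vertices v_0,…,v_{n-1} (v_i ↔ i : Fin n)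
H : (m n : ℕ) → AdjRel n
H m n u v = hararyAdjℕ m n (toℕ u) (toℕ v)

module Submission where

-- For even n = 2h the graph H_{3,n} is 3-regular. Summing the magic constant k over all
-- vertices counts every label three times, so n k = 3 (1 + ⋯ + n) and 2k = 3 (n + 1),
-- which is odd. For odd n = 2m + 1 ≥ 7 the vertices v₁ and v_{m+1} have neighbourhoods
-- {v_{m+2}, v₀, v₂} and {v_{m+2}, v₀, v_m}; equal weights force v₂ and v_m to carry the
-- same label, although m ≠ 2. For n = 5 an explicit labeling works.

open import Defs
open import Data.Bool using (Bool; true; false; T; if_then_else_; not; _∧_; _∨_)
open import Data.Bool.Properties using (∨-comm; T-∧; T-∨)
open import Data.Empty using (⊥-elim)
open import Data.Fin as Fin using (Fin; toℕ; fromℕ; fromℕ<; inject₁)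
open import Data.Fin.Patterns using (0F; 1F; 2F; 3F; 4F)
open import Data.Fin.Properties using (toℕ-inject₁; toℕ-fromℕ; toℕ-fromℕ<; toℕ-injective; fromℕ<-injective; toℕ<n)
open import Data.List using (tabulate)
open import Data.List.Properties using (map-tabulate)
open import Data.Nat using (ℕ; zero; suc; _+_; _*_; _∸_; _≤_; _<_; _⊓_; _⊔_; _/_; _%_; z≤n; s≤s; z<s; NonZero; >-nonZero)
open import Data.Nat.DivMod using (m*n/n≡m; m*n%n≡0; [m+kn]%n≡m%n)
open import Data.Nat.Divisibility using (_∣_; divides; ∣m+n∣m⇒∣n; ∣1⇒≡1; m∣m*n)
import Data.Nat.ListAction as List
open import Data.Nat.Properties
open import Algebra.Properties.Semiring.Sum +-*-semiring
  using (sum-syntax; sum-cong-≗; sum-init-last; ∑-comm; ∑-distrib-+; ∑-permute; *-distribˡ-sum; *-distribʳ-sum)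
open import Data.Nat.Tactic.RingSolver using (solve-∀)
open import Data.Product using (∃-syntax; _×_; _,_; proj₁; proj₂)
import Data.Product as Product
open import Data.Product.Function.NonDependent.Propositional using (_×-⇔_)
open import Data.Sum using (_⊎_; inj₁; inj₂; [_,_])
import Data.Sum as Sum
open import Data.Sum.Function.Propositional using (_⊎-⇔_)
open import Function using (_∘_; id)
open import Function.Bundles using (_⇔_; mk⇔; Equivalence; _⤖_; Bijection; mk↔ₛ′)
open import Function.Properties.Bijection using (⤖⇒↔)
import Function.Properties.Equivalence as ⇔
open import Function.Properties.Inverse using (↔⇒⇔; ↔⇒⤖)
open import Function.Related.Propositional using (module EquationalReasoning; equivalence)
open import Function.Related.TypeIsomorphisms using (⊎-assoc; ⊎-comm)
open import Level using (0ℓ)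
open import Relation.Binary using (tri<; tri≈; tri>)
open import Relation.Binary.PropositionalEquality hiding ([_])
open import Relation.Nullary using (¬_; Dec; yes; no; contradiction)
open import Relation.Nullary.Decidable using (⌊_⌋; toWitness; fromWitness; toWitnessFalse; fromWitnessFalse)

sum-tabulate : ∀ {n} (f : Fin n → ℕ) → List.sum (tabulate f) ≡ ∑[ i < n ] f i
sum-tabulate {zero}  f = refl
sum-tabulate {suc n} f = cong (f Fin.zero +_) (sum-tabulate (f ∘ Fin.suc))

∑-const : ∀ n k → ∑[ i < n ] k ≡ n * k
∑-const zero    k = refl
∑-const (suc n) k = cong (k +_) (∑-const n k)

2*∑[1+i]≡n*[1+n] : ∀ n → 2 * ∑[ i < n ] suc (toℕ i) ≡ n * suc n
2*∑[1+i]≡n*[1+n] zero    = refl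
2*∑[1+i]≡n*[1+n] (suc n) = begin
  2 * ∑[ i < suc n ] suc (toℕ i)                                ≡⟨ cong (2 *_) (sum-init-last {n} (suc ∘ toℕ)) ⟩
  2 * (∑[ i < n ] suc (toℕ (inject₁ i)) + suc (toℕ (fromℕ n))) ≡⟨ cong₂ (λ s t → 2 * (s + suc t)) ∑-inject₁ (toℕ-fromℕ n) ⟩
  2 * (∑[ i < n ] suc (toℕ i) + suc n)                          ≡⟨ *-distribˡ-+ 2 (∑[ i < n ] suc (toℕ i)) (suc n) ⟩
  2 * ∑[ i < n ] suc (toℕ i) + 2 * suc n                        ≡⟨ cong (_+ 2 * suc n) (2*∑[1+i]≡n*[1+n] n) ⟩
  n * suc n + 2 * suc n                                         ≡⟨ regroup n ⟩
  suc n * suc (suc n)                                           ∎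
  where
  open ≡-Reasoning
  ∑-inject₁ : ∑[ i < n ] suc (toℕ (inject₁ i)) ≡ ∑[ i < n ] suc (toℕ i)
  ∑-inject₁ = sum-cong-≗ {n} {suc ∘ toℕ ∘ inject₁} {suc ∘ toℕ} (cong suc ∘ toℕ-inject₁)
  regroup : ∀ n → n * suc n + 2 * suc n ≡ suc n * suc (suc n)
  regroup = solve-∀

point : ∀ {n} → Fin n → ℕ → Fin n → ℕ
point a x v = if ⌊ v Fin.≟ a ⌋ then x else 0

point-≡ : ∀ {n} (a : Fin n) x → point a x a ≡ x
point-≡ a x with a Fin.≟ a
... | yes _   = refl
... | no a≢a = contradiction refl a≢a

point-≢ : ∀ {n} {a v : Fin n} x → v ≢ a → point a x v ≡ 0
point-≢ {a = a} {v} x v≢a with v Fin.≟ a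
... | yes v≡a = contradiction v≡a v≢a
... | no _    = refl

∑-point : ∀ {n} (a : Fin n) x → ∑[ v < n ] point a x v ≡ x
∑-point {suc n} Fin.zero x = begin
  x + ∑[ v < n ] point Fin.zero x (Fin.suc v) ≡⟨ cong (x +_) (sum-cong-≗ {n} {point Fin.zero x ∘ Fin.suc} {λ _ → 0} off-zero) ⟩
  x + ∑[ v < n ] 0                           ≡⟨ cong (x +_) (trans (∑-const n 0) (*-zeroʳ n)) ⟩
  x + 0                                      ≡⟨ +-identityʳ x ⟩
  x                                          ∎
  where
  open ≡-Reasoning
  off-zero : ∀ v → point Fin.zero x (Fin.suc v) ≡ 0
  off-zero v = point-≢ {a = Fin.zero} {Fin.suc v} x λ ()
∑-point {suc n} (Fin.suc a) x = trans (sum-cong-≗ shift) (∑-point a x)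
  where
  shift : ∀ v → point (Fin.suc a) x (Fin.suc v) ≡ point a x v
  shift v with v Fin.≟ a
  ... | yes _ = refl
  ... | no _  = refl

Symmetric : ∀ {n} → AdjRel n → Set
Symmetric adj = ∀ u v → adj u v ≡ adj v u

degree : ∀ {n} → AdjRel n → Fin n → ℕ
degree adj = weight adj (λ _ → 1)

label : ∀ {n} → Fin n ⤖ Fin n → Fin n → ℕ
label σ v = suc (toℕ (Bijection.to σ v))

weight≡∑ : ∀ {n} (adj : AdjRel n) ℓ u → weight adj ℓ u ≡ ∑[ v < n ] (if adj u v then ℓ v else 0)
weight≡∑ {n} adj ℓ u = trans (cong List.sum (map-tabulate id term)) (sum-tabulate term)
  where
  term : Fin n → ℕ
  term v = if adj u v then ℓ v else 0

∑-handshake : ∀ {n} {adj : AdjRel n} → Symmetric adj → ∀ ℓ →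
              ∑[ u < n ] weight adj ℓ u ≡ ∑[ v < n ] (degree adj v * ℓ v)
∑-handshake {n} {adj} adj-sym ℓ = begin
  ∑[ u < n ] weight adj ℓ u                                 ≡⟨ sum-cong-≗ (weight≡∑ adj ℓ) ⟩
  ∑[ u < n ] ∑[ v < n ] (if adj u v then ℓ v else 0)         ≡⟨ ∑-comm (λ u v → if adj u v then ℓ v else 0) ⟩
  ∑[ v < n ] ∑[ u < n ] (if adj u v then ℓ v else 0)         ≡⟨ sum-cong-≗ (λ v → sum-cong-≗ (transpose v)) ⟩
  ∑[ v < n ] ∑[ u < n ] ((if adj v u then 1 else 0) * ℓ v)   ≡⟨ sum-cong-≗ (λ v → *-distribʳ-sum (ℓ v) (indicator v)) ⟨
  ∑[ v < n ] ((∑[ u < n ] (if adj v u then 1 else 0)) * ℓ v) ≡⟨ sum-cong-≗ (λ v → cong (_* ℓ v) (weight≡∑ adj _ v)) ⟨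
  ∑[ v < n ] (degree adj v * ℓ v)                           ∎
  where
  open ≡-Reasoning
  indicator : Fin n → Fin n → ℕ
  indicator v u = if adj v u then 1 else 0
  if-then-x≡if-then-1*x : ∀ b x → (if b then x else 0) ≡ (if b then 1 else 0) * x
  if-then-x≡if-then-1*x true  x = sym (*-identityˡ x)
  if-then-x≡if-then-1*x false x = refl
  transpose : ∀ v u → (if adj u v then ℓ v else 0) ≡ indicator v u * ℓ v
  transpose v u = trans (cong (λ b → if b then ℓ v else 0) (adj-sym u v)) (if-then-x≡if-then-1*x (adj v u) (ℓ v))

∑-label : ∀ {n} (σ : Fin n ⤖ Fin n) → 2 * ∑[ v < n ] label σ v ≡ n * suc n
∑-label {n} σ = trans (cong (2 *_) (sym (∑-permute (suc ∘ toℕ) (⤖⇒↔ σ)))) (2*∑[1+i]≡n*[1+n] n)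

distanceMagic-regular⇒2∣ : ∀ {n r} {adj : AdjRel n} .{{_ : NonZero n}} →
                           Symmetric adj → (∀ u → degree adj u ≡ r) →
                           DistanceMagic adj → 2 ∣ r * suc n
distanceMagic-regular⇒2∣ {n} {r} {adj} adj-sym regular (σ , k , magic) =
  divides k (*-cancelˡ-≡ (r * suc n) (k * 2) n n*[r*[1+n]]≡n*[k*2])
  where
  open ≡-Reasoning
  Σℓ : ℕ
  Σℓ = ∑[ v < n ] label σ v
  swap : ∀ a b c → a * (b * c) ≡ b * (a * c)
  swap = solve-∀
  n*[r*[1+n]]≡n*[k*2] : n * (r * suc n) ≡ n * (k * 2)
  n*[r*[1+n]]≡n*[k*2] = begin
    n * (r * suc n)                           ≡⟨ swap n r (suc n) ⟩
    r * (n * suc n)                           ≡⟨ cong (r *_) (∑-label σ) ⟨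
    r * (2 * Σℓ)                              ≡⟨ swap r 2 Σℓ ⟩
    2 * (r * Σℓ)                              ≡⟨ cong (2 *_) (*-distribˡ-sum r (label σ)) ⟩
    2 * ∑[ v < n ] (r * label σ v)            ≡⟨ cong (2 *_) (sum-cong-≗ (λ v → cong (_* label σ v) (regular v))) ⟨
    2 * ∑[ v < n ] (degree adj v * label σ v) ≡⟨ cong (2 *_) (∑-handshake adj-sym (label σ)) ⟨
    2 * ∑[ u < n ] weight adj (label σ) u     ≡⟨ cong (2 *_) (sum-cong-≗ magic) ⟩
    2 * ∑[ u < n ] k                          ≡⟨ cong (2 *_) (∑-const n k) ⟩
    2 * (n * k)                               ≡⟨ swap 2 n k ⟩
    n * (2 * k)                               ≡⟨ cong (n *_) (*-comm 2 k) ⟩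
    n * (k * 2)                               ∎

¬2∣1+2* : ∀ q → ¬ 2 ∣ 1 + 2 * q
¬2∣1+2* q 2∣1+2q with ∣1⇒≡1 (∣m+n∣m⇒∣n (subst (2 ∣_) (+-comm 1 (2 * q)) 2∣1+2q) (m∣m*n q))
... | ()

Neighbours₃ : ∀ {n} → AdjRel n → Fin n → (a b c : Fin n) → Set
Neighbours₃ adj u a b c = a ≢ b × a ≢ c × b ≢ c × (∀ v → T (adj u v) ⇔ (v ≡ a ⊎ v ≡ b ⊎ v ≡ c))

weight-neighbours₃ : ∀ {n} {adj : AdjRel n} {u a b c} → Neighbours₃ adj u a b c →
                     ∀ ℓ → weight adj ℓ u ≡ ℓ a + ℓ b + ℓ c
weight-neighbours₃ {n} {adj} {u} {a} {b} {c} (a≢b , a≢c , b≢c , N) ℓ = begin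
  weight adj ℓ u                                     ≡⟨ weight≡∑ adj ℓ u ⟩
  ∑[ v < n ] (if adj u v then ℓ v else 0)             ≡⟨ sum-cong-≗ split ⟩
  ∑[ v < n ] (pa v + pb v + pc v)                    ≡⟨ ∑-distrib-+ (λ v → pa v + pb v) pc ⟩
  ∑[ v < n ] (pa v + pb v) + ∑[ v < n ] pc v          ≡⟨ cong (_+ ∑[ v < n ] pc v) (∑-distrib-+ pa pb) ⟩
  ∑[ v < n ] pa v + ∑[ v < n ] pb v + ∑[ v < n ] pc v ≡⟨ cong₂ _+_ (cong₂ _+_ (∑-point a (ℓ a)) (∑-point b (ℓ b))) (∑-point c (ℓ c)) ⟩
  ℓ a + ℓ b + ℓ c                                     ∎
  where
  open ≡-Reasoning
  pa pb pc : Fin n → ℕ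
  pa = point a (ℓ a)
  pb = point b (ℓ b)
  pc = point c (ℓ c)
  at-a : pa a + pb a + pc a ≡ ℓ a
  at-a = trans (cong₂ _+_ (cong₂ _+_ (point-≡ a (ℓ a)) (point-≢ (ℓ b) a≢b)) (point-≢ (ℓ c) a≢c))
               (trans (+-identityʳ _) (+-identityʳ _))
  at-b : pa b + pb b + pc b ≡ ℓ b
  at-b = trans (cong₂ _+_ (cong₂ _+_ (point-≢ (ℓ a) (a≢b ∘ sym)) (point-≡ b (ℓ b))) (point-≢ (ℓ c) b≢c))
               (+-identityʳ _)
  at-c : pa c + pb c + pc c ≡ ℓ c
  at-c = cong₂ _+_ (cong₂ _+_ (point-≢ (ℓ a) (a≢c ∘ sym)) (point-≢ (ℓ b) (b≢c ∘ sym))) (point-≡ c (ℓ c))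
  split : ∀ v → (if adj u v then ℓ v else 0) ≡ pa v + pb v + pc v
  split v with adj u v in uv
  ... | true  = [ (λ { refl → sym at-a }) , [ (λ { refl → sym at-b }) , (λ { refl → sym at-c }) ] ]
                  (Equivalence.to (N v) (subst T (sym uv) _))
  ... | false = sym (cong₂ _+_ (cong₂ _+_ (point-≢ (ℓ a) (absent ∘ inj₁)) (point-≢ (ℓ b) (absent ∘ inj₂ ∘ inj₁)))
                               (point-≢ (ℓ c) (absent ∘ inj₂ ∘ inj₂)))
    where
    absent : ¬ (v ≡ a ⊎ v ≡ b ⊎ v ≡ c)
    absent = subst T uv ∘ Equivalence.from (N v)

distanceMagic-twins : ∀ {n} {adj : AdjRel n} → DistanceMagic adj →
                      ∀ {u v a b x y} → Neighbours₃ adj u a b x → Neighbours₃ adj v a b y → x ≡ y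
distanceMagic-twins {adj = adj} (σ , k , magic) {u} {v} {a} {b} {x} {y} Nu Nv =
  Bijection.injective σ (toℕ-injective (suc-injective labels-agree))
  where
  open ≡-Reasoning
  labels-agree : label σ x ≡ label σ y
  labels-agree = +-cancelˡ-≡ (label σ a + label σ b) (label σ x) (label σ y) (begin
    label σ a + label σ b + label σ x ≡⟨ weight-neighbours₃ {adj = adj} Nu (label σ) ⟨
    weight adj (label σ) u            ≡⟨ trans (magic u) (sym (magic v)) ⟩
    weight adj (label σ) v            ≡⟨ weight-neighbours₃ {adj = adj} Nv (label σ) ⟩
    label σ a + label σ b + label σ y ∎)

toℕ≡⇔≡fromℕ< : ∀ {n a} {v : Fin n} (a<n : a < n) → toℕ v ≡ a ⇔ v ≡ fromℕ< a<n
toℕ≡⇔≡fromℕ< a<n = mk⇔ (λ e → toℕ-injective (trans e (sym (toℕ-fromℕ< a<n)))) (λ { refl → toℕ-fromℕ< a<n })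

neighbours₃-fromℕ : ∀ {n} (A : ℕ → ℕ → Bool) {u : Fin n} {i a b c} → toℕ u ≡ i →
                    (a<n : a < n) (b<n : b < n) (c<n : c < n) → a ≢ b → a ≢ c → b ≢ c →
                    (∀ {j} → j < n → T (A i j) ⇔ (j ≡ a ⊎ j ≡ b ⊎ j ≡ c)) →
                    Neighbours₃ (λ v w → A (toℕ v) (toℕ w)) u (fromℕ< a<n) (fromℕ< b<n) (fromℕ< c<n)
neighbours₃-fromℕ A refl a<n b<n c<n a≢b a≢c b≢c N =
  a≢b ∘ fromℕ<-injective _ _ a<n b<n ,
  a≢c ∘ fromℕ<-injective _ _ a<n c<n ,
  b≢c ∘ fromℕ<-injective _ _ b<n c<n ,
  λ v → ⇔.trans (N (toℕ<n v)) (toℕ≡⇔≡fromℕ< a<n ⊎-⇔ toℕ≡⇔≡fromℕ< b<n ⊎-⇔ toℕ≡⇔≡fromℕ< c<n)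

modN-< : ∀ {n k} → k < n → modN n k ≡ k
modN-< {n} {k} k<n with k <? n
... | yes _   = refl
... | no k≮n = contradiction k<n k≮n

modN-≥ : ∀ {n k} → n ≤ k → modN n k ≡ k ∸ n
modN-≥ {n} {k} n≤k with k <? n
... | yes k<n = contradiction n≤k (<⇒≱ k<n)
... | no _    = refl

modN-self : ∀ n → modN n n ≡ 0
modN-self n = trans (modN-≥ (≤-refl {n})) (n∸n≡0 n)

modN<n : ∀ {n k} → k < n + n → modN n k < n
modN<n {n} {k} k<2n with k <? n
... | yes k<n = k<n
... | no k≮n = subst (k ∸ n <_) (m+n∸n≡m n n) (∸-monoˡ-< k<2n (≮⇒≥ k≮n))

m+n∸o<m : ∀ {m n o} → o ≤ m + n → n < o → m + n ∸ o < m
m+n∸o<m {m} {n} {o} o≤m+n n<o = subst (m + n ∸ o <_) (m+n∸n≡m m o) (∸-monoˡ-< (+-monoʳ-< m n<o) o≤m+n)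

modN-+-injective : ∀ {n i d e} → d < n → e < n → modN n (i + d) ≡ modN n (i + e) → d ≡ e
modN-+-injective {n} {i} {d} {e} d<n e<n eq with i + d <? n | i + e <? n
... | yes _ | yes _ = +-cancelˡ-≡ i d e eq
... | no p  | no q  = +-cancelˡ-≡ i d e (∸-cancelʳ-≡ (≮⇒≥ p) (≮⇒≥ q) eq)
... | yes _ | no q  = contradiction (≤-trans (m≤m+n i d) (≤-reflexive eq)) (<⇒≱ (m+n∸o<m (≮⇒≥ q) e<n))
... | no p  | yes _ = contradiction (≤-trans (m≤m+n i e) (≤-reflexive (sym eq))) (<⇒≱ (m+n∸o<m (≮⇒≥ p) d<n))

modN-+-distinct : ∀ {n i d e} → d ≢ e → d < n → e < n → modN n (i + d) ≢ modN n (i + e)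
modN-+-distinct d≢e d<n e<n = d≢e ∘ modN-+-injective d<n e<n

modN-+-≢ : ∀ {n i j d} → i < n → 1 ≤ d → d < n → j ≡ modN n (i + d) → i ≢ j
modN-+-≢ {n} {i} i<n 1≤d d<n refl i≡ = <⇒≢ 1≤d (modN-+-injective (≤-<-trans z≤n d<n) d<n
  (trans (cong (modN n) (+-identityʳ i)) (trans (modN-< i<n) i≡)))

modN-+-inverse : ∀ {n i j d} → i < n → d ≤ n → j ≡ modN n (i + d) → i ≡ modN n (j + (n ∸ d))
modN-+-inverse {n} {i} {j} {d} i<n d≤n j≡ = sym (trans (cong (λ x → modN n (x + (n ∸ d))) j≡) (unwind (i + d <? n)))
  where
  open ≡-Reasoning
  i+d+[n∸d]≡i+n : i + d + (n ∸ d) ≡ i + n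
  i+d+[n∸d]≡i+n = trans (+-assoc i d (n ∸ d)) (cong (i +_) (m+[n∸m]≡n d≤n))
  unwind : Dec (i + d < n) → modN n (modN n (i + d) + (n ∸ d)) ≡ i
  unwind (yes i+d<n) = begin
    modN n (modN n (i + d) + (n ∸ d)) ≡⟨ cong (λ x → modN n (x + (n ∸ d))) (modN-< i+d<n) ⟩
    modN n (i + d + (n ∸ d))          ≡⟨ cong (modN n) i+d+[n∸d]≡i+n ⟩
    modN n (i + n)                    ≡⟨ modN-≥ (m≤n+m n i) ⟩
    i + n ∸ n                         ≡⟨ m+n∸n≡m i n ⟩
    i                                 ∎
  unwind (no i+d≮n) = begin
    modN n (modN n (i + d) + (n ∸ d)) ≡⟨ cong (λ x → modN n (x + (n ∸ d))) (modN-≥ (≮⇒≥ i+d≮n)) ⟩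
    modN n (i + d ∸ n + (n ∸ d))      ≡⟨ cong (modN n) (+-∸-comm (n ∸ d) (≮⇒≥ i+d≮n)) ⟨
    modN n (i + d + (n ∸ d) ∸ n)      ≡⟨ cong (λ x → modN n (x ∸ n)) i+d+[n∸d]≡i+n ⟩
    modN n (i + n ∸ n)                ≡⟨ cong (modN n) (m+n∸n≡m i n) ⟩
    modN n i                          ≡⟨ modN-< i<n ⟩
    i                                 ∎

-- The Harary graph H_{m,n}

T-eqᵇ : ∀ {a b} → T (eqᵇ a b) ⇔ a ≡ b
T-eqᵇ = mk⇔ toWitness fromWitness

T-not-eqᵇ : ∀ {a b} → T (not (eqᵇ a b)) ⇔ a ≢ b
T-not-eqᵇ = mk⇔ toWitnessFalse fromWitnessFalse

T-leᵇ : ∀ {a b} → T (leᵇ a b) ⇔ a ≤ b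
T-leᵇ = mk⇔ toWitness fromWitness

T-ltᵇ : ∀ {a b} → T (ltᵇ a b) ⇔ a < b
T-ltᵇ = mk⇔ toWitness fromWitness

T-symmetrised : ∀ {i j} E X Y → T (not (eqᵇ i j) ∧ (E ∨ X ∨ Y)) ⇔ (i ≢ j × (T E ⊎ T X ⊎ T Y))
T-symmetrised {i} {j} E X Y = ⇔.trans (T-∧ {not (eqᵇ i j)}) (T-not-eqᵇ ×-⇔ ⇔.trans (T-∨ {E}) (⇔.refl ⊎-⇔ T-∨ {X}))

≢-redundant : ∀ {i j : ℕ} {P : Set} → (P → i ≢ j) → (i ≢ j × P) ⇔ P
≢-redundant P⇒i≢j = mk⇔ proj₂ (λ p → P⇒i≢j p , p)

⊎-dropˡ : ∀ {A B : Set} → ¬ A → (A ⊎ B) ⇔ B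
⊎-dropˡ ¬a = mk⇔ [ ⊥-elim ∘ ¬a , id ] inj₂

⊎-dropʳ : ∀ {A B : Set} → ¬ B → (A ⊎ B) ⇔ A
⊎-dropʳ ¬b = mk⇔ [ id , ⊥-elim ∘ ¬b ] inj₁

≡-congʳ-⇔ : ∀ {j a b : ℕ} → a ≡ b → j ≡ a ⇔ j ≡ b
≡-congʳ-⇔ a≡b = mk⇔ (λ e → trans e a≡b) (λ e → trans e (sym a≡b))

≡modN⇔≡ : ∀ {n j k} → k < n → j ≡ modN n k ⇔ j ≡ k
≡modN⇔≡ k<n = ≡-congʳ-⇔ (modN-< k<n)

eqᵇ-comm : ∀ a b → eqᵇ a b ≡ eqᵇ b a
eqᵇ-comm a b with a ≟ b | b ≟ a
... | yes _   | yes _   = refl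
... | no _    | no _    = refl
... | yes a≡b | no b≢a  = contradiction (sym a≡b) b≢a
... | no a≢b  | yes b≡a = contradiction (sym b≡a) a≢b

cdist-comm : ∀ n i j → cdist n i j ≡ cdist n j i
cdist-comm n i j = cong (λ d → d ⊓ (n ∸ d)) (⊔-comm (i ∸ j) (j ∸ i))

evenAdj-comm : ∀ m n i j → evenAdj m n i j ≡ evenAdj m n j i
evenAdj-comm m n i j = cong₂ (λ e d → not e ∧ leᵇ d (m / 2)) (eqᵇ-comm i j) (cdist-comm n i j)

symmetrised-comm : ∀ (E X : ℕ → ℕ → Bool) → (∀ i j → E i j ≡ E j i) → ∀ i j →
                   not (eqᵇ i j) ∧ (E i j ∨ X i j ∨ X j i) ≡ not (eqᵇ j i) ∧ (E j i ∨ X j i ∨ X i j)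
symmetrised-comm E X E-comm i j =
  cong₂ (λ e z → not e ∧ z) (eqᵇ-comm i j) (cong₂ _∨_ (E-comm i j) (∨-comm (X i j) (X j i)))

hararyAdjℕ-comm : ∀ m n i j → hararyAdjℕ m n i j ≡ hararyAdjℕ m n j i
hararyAdjℕ-comm m n i j with isEven m | isEven n
... | true  | _     = evenAdj-comm m n i j
... | false | true  = symmetrised-comm (evenAdj (m ∸ 1) n) (oddEvenExtra n) (evenAdj-comm (m ∸ 1) n) i j
... | false | false = symmetrised-comm (evenAdj (m ∸ 1) n) (oddOddExtra n) (evenAdj-comm (m ∸ 1) n) i j

H-symmetric : ∀ m n → Symmetric (H m n)
H-symmetric m n u v = hararyAdjℕ-comm m n (toℕ u) (toℕ v)

<⇒∃+suc : ∀ {a b} → a < b → ∃[ d ] b ≡ a + suc d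
<⇒∃+suc {a} {b} a<b = b ∸ suc a , sym (trans (+-suc a (b ∸ suc a)) (m+[n∸m]≡n a<b))

m⊓n≤1⇒m≤1⊎n≤1 : ∀ m n → m ⊓ n ≤ 1 → m ≤ 1 ⊎ n ≤ 1
m⊓n≤1⇒m≤1⊎n≤1 m n m⊓n≤1 = Sum.map (λ e → subst (_≤ 1) e m⊓n≤1) (λ e → subst (_≤ 1) e m⊓n≤1) (⊓-sel m n)

m+suc-n≤1⇒m≡0×n≡0 : ∀ m n → m + suc n ≤ 1 → m ≡ 0 × n ≡ 0
m+suc-n≤1⇒m≡0×n≡0 zero    zero    _       = refl , refl
m+suc-n≤1⇒m≡0×n≡0 zero    (suc n) (s≤s ())
m+suc-n≤1⇒m≡0×n≡0 (suc m) n       (s≤s p) = contradiction (trans (sym (+-suc m n)) (n≤0⇒n≡0 p)) λ ()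

∣i-i+d∣≡d : ∀ i d → ∣ i - i + d ∣ ≡ d
∣i-i+d∣≡d i d = cong₂ _⊔_ (m≤n⇒m∸n≡0 (m≤m+n i d)) (m+n∸m≡n i d)

cdist-gap : ∀ i d e → cdist (i + suc d + suc e) i (i + suc d) ≡ suc d ⊓ (i + suc e)
cdist-gap i d e = begin
  cdist (i + suc d + suc e) i (i + suc d) ≡⟨ cong (λ D → D ⊓ (i + suc d + suc e ∸ D)) (∣i-i+d∣≡d i (suc d)) ⟩
  suc d ⊓ (i + suc d + suc e ∸ suc d)     ≡⟨ cong (λ x → suc d ⊓ (x ∸ suc d)) (rearrange i (suc d) (suc e)) ⟩
  suc d ⊓ (suc d + (i + suc e) ∸ suc d)   ≡⟨ cong (suc d ⊓_) (m+n∸m≡n (suc d) (i + suc e)) ⟩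
  suc d ⊓ (i + suc e)                     ∎
  where
  open ≡-Reasoning
  rearrange : ∀ a b c → a + b + c ≡ b + (a + c)
  rearrange = solve-∀

cdist≤1⇒step-< : ∀ {n i j} → i < j → j < n → cdist n i j ≤ 1 → j ≡ modN n (i + 1) ⊎ i ≡ modN n (j + 1)
cdist≤1⇒step-< {i = i} i<j j<n c≤1 with <⇒∃+suc i<j | <⇒∃+suc j<n
... | d , refl | e , refl with m⊓n≤1⇒m≤1⊎n≤1 (suc d) (i + suc e) (subst (_≤ 1) (cdist-gap i d e) c≤1)
... | inj₁ (s≤s z≤n) = inj₁ (sym (modN-< j<n))
... | inj₂ i+1+e≤1 with m+suc-n≤1⇒m≡0×n≡0 i e i+1+e≤1
... | refl , refl = inj₂ (sym (modN-self (suc d + 1)))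

cdist≤1⇒step : ∀ {n i j} → i < n → j < n → i ≢ j → cdist n i j ≤ 1 → j ≡ modN n (i + 1) ⊎ i ≡ modN n (j + 1)
cdist≤1⇒step {n} {i} {j} i<n j<n i≢j c≤1 with <-cmp i j
... | tri< i<j _ _ = cdist≤1⇒step-< i<j j<n c≤1
... | tri≈ _ i≡j _ = contradiction i≡j i≢j
... | tri> _ _ j<i = Sum.swap (cdist≤1⇒step-< j<i i<n (subst (_≤ 1) (cdist-comm n i j) c≤1))

cdist-i-i+1≤1 : ∀ n i → cdist n i (i + 1) ≤ 1
cdist-i-i+1≤1 n i = subst (λ D → D ⊓ (n ∸ D) ≤ 1) (sym (∣i-i+d∣≡d i 1)) (m⊓n≤m 1 (n ∸ 1))

cdist-i-0≤1 : ∀ i → cdist (i + 1) i 0 ≤ 1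
cdist-i-0≤1 i = subst (λ D → D ⊓ (i + 1 ∸ D) ≤ 1) (sym ∣i-0∣≡i) (subst (λ x → i ⊓ x ≤ 1) (sym (m+n∸m≡n i 1)) (m⊓n≤n i 1))
  where
  ∣i-0∣≡i : ∣ i - 0 ∣ ≡ i
  ∣i-0∣≡i = trans (cong (i ⊔_) (0∸n≡0 i)) (⊔-identityʳ i)

step⇒cdist≤1 : ∀ {n i j} → 2 ≤ n → i < n → j ≡ modN n (i + 1) → i ≢ j × cdist n i j ≤ 1
step⇒cdist≤1 {n} {i} 2≤n i<n j≡ with i + 1 <? n
step⇒cdist≤1 {n} {i} 2≤n i<n refl | yes _ = <⇒≢ (m<m+n i z<s) , cdist-i-i+1≤1 n i
step⇒cdist≤1 {n} {i} 2≤n i<n refl | no i+1≮n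
  with ≤-antisym (subst (_≤ n) (+-comm 1 i) i<n) (≮⇒≥ i+1≮n)
... | refl rewrite n∸n≡0 (i + 1) =
  (λ i≡0 → contradiction (subst (λ x → 2 ≤ x + 1) i≡0 2≤n) λ { (s≤s ()) }) , cdist-i-0≤1 i

step⇒≢ : ∀ {n i j} → 2 ≤ n → i < n → j ≡ modN n (i + 1) ⊎ j ≡ modN n (i + (n ∸ 1)) → i ≢ j
step⇒≢ 2≤n i<n =
  [ modN-+-≢ i<n ≤-refl 2≤n , modN-+-≢ i<n (m<n⇒0<n∸m 2≤n) (∸-monoʳ-< z<s (≤-trans (s≤s z≤n) 2≤n)) ]

T-evenAdj-2 : ∀ {n i j} → 2 ≤ n → i < n → j < n →
              T (evenAdj 2 n i j) ⇔ (j ≡ modN n (i + 1) ⊎ j ≡ modN n (i + (n ∸ 1)))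
T-evenAdj-2 {n} {i} {j} 2≤n i<n j<n = ⇔.trans (⇔.trans T-∧ (T-not-eqᵇ ×-⇔ T-leᵇ)) (mk⇔ to from)
  where
  1≤n : 1 ≤ n
  1≤n = ≤-trans (s≤s z≤n) 2≤n
  to : i ≢ j × cdist n i j ≤ 1 → j ≡ modN n (i + 1) ⊎ j ≡ modN n (i + (n ∸ 1))
  to (i≢j , c≤1) = Sum.map₂ (modN-+-inverse j<n 1≤n) (cdist≤1⇒step i<n j<n i≢j c≤1)
  from : j ≡ modN n (i + 1) ⊎ j ≡ modN n (i + (n ∸ 1)) → i ≢ j × cdist n i j ≤ 1
  from (inj₁ j≡) = step⇒cdist≤1 2≤n i<n j≡
  from (inj₂ j≡) = Product.map (_∘ sym) (subst (_≤ 1) (cdist-comm n j i)) (step⇒cdist≤1 2≤n j<n i≡)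
    where
    i≡ : i ≡ modN n (j + 1)
    i≡ = subst (λ d → i ≡ modN n (j + d)) (m∸[m∸n]≡n 1≤n) (modN-+-inverse i<n (m∸n≤m n 1) j≡)

-- H_{3,n} for even n = h + h

double≡*2 : ∀ h → h + h ≡ h * 2
double≡*2 = solve-∀

isEven-double : ∀ h → isEven (h + h) ≡ true
isEven-double h = cong (λ r → eqᵇ r 0) (trans (cong (_% 2) (double≡*2 h)) (m*n%n≡0 h 2))

half-double : ∀ h → (h + h) / 2 ≡ h
half-double h = trans (cong (_/ 2) (double≡*2 h)) (m*n/n≡m h 2)

hararyAdjℕ-3-even : ∀ {n} → isEven n ≡ true → ∀ i j →
                    hararyAdjℕ 3 n i j ≡ not (eqᵇ i j) ∧ (evenAdj 2 n i j ∨ oddEvenExtra n i j ∨ oddEvenExtra n j i)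
hararyAdjℕ-3-even {n} even i j with isEven n
hararyAdjℕ-3-even {n} refl i j | true = refl

HalfTurn : ℕ → ℕ → ℕ → Set
HalfTurn h i j = 1 ≤ i × i ≤ h × j ≡ modN (h + h) (i + h)

T-oddEvenExtra : ∀ {h i j} → T (oddEvenExtra (h + h) i j) ⇔ HalfTurn h i j
T-oddEvenExtra {h} rewrite half-double h = ⇔.trans T-∧ (T-leᵇ ×-⇔ ⇔.trans T-∧ (T-leᵇ ×-⇔ T-eqᵇ))

halfTurn-inverse : ∀ {h i j} → i < h + h → j ≡ modN (h + h) (i + h) → i ≡ modN (h + h) (j + h)
halfTurn-inverse {h} {i} {j} i<2h j≡ =
  subst (λ d → i ≡ modN (h + h) (j + d)) (m+n∸n≡m h h) (modN-+-inverse i<2h (m≤n+m h h) j≡)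

modN⇒halfTurn : ∀ {h i j} → 1 ≤ h → i < h + h → j ≡ modN (h + h) (i + h) → HalfTurn h i j ⊎ HalfTurn h j i
modN⇒halfTurn {h} {zero} {j} 1≤h _ j≡ =
  inj₂ (subst (λ x → HalfTurn h x 0) (sym (trans j≡ (modN-< (m<m+n h 1≤h)))) (1≤h , ≤-refl , sym (modN-self (h + h))))
modN⇒halfTurn {h} {suc p} {j} 1≤h i<2h j≡ with suc p ≤? h
... | yes i≤h = inj₁ (s≤s z≤n , i≤h , j≡)
... | no i≰h = inj₂ (subst (1 ≤_) (sym j≡i∸h) (m<n⇒0<n∸m h<i) ,
                     subst (_≤ h) (sym j≡i∸h) (<⇒≤ (subst (suc p ∸ h <_) (m+n∸n≡m h h) (∸-monoˡ-< i<2h (<⇒≤ h<i)))) ,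
                     halfTurn-inverse {h} i<2h j≡)
  where
  open ≡-Reasoning
  h<i : h < suc p
  h<i = ≰⇒> i≰h
  j≡i∸h : j ≡ suc p ∸ h
  j≡i∸h = begin
    j                        ≡⟨ j≡ ⟩
    modN (h + h) (suc p + h) ≡⟨ modN-≥ (+-monoˡ-≤ h (<⇒≤ h<i)) ⟩
    suc p + h ∸ (h + h)      ≡⟨ cong (_∸ (h + h)) (+-comm (suc p) h) ⟩
    h + suc p ∸ (h + h)      ≡⟨ [m+n]∸[m+o]≡n∸o h (suc p) h ⟩
    suc p ∸ h                ∎

halfTurns⇔ : ∀ {h i j} → 1 ≤ h → i < h + h → j < h + h →
             (HalfTurn h i j ⊎ HalfTurn h j i) ⇔ j ≡ modN (h + h) (i + h)
halfTurns⇔ {h} 1≤h i<2h j<2h =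
  mk⇔ [ proj₂ ∘ proj₂ , halfTurn-inverse {h} j<2h ∘ proj₂ ∘ proj₂ ] (modN⇒halfTurn 1≤h i<2h)

hararyAdjℕ-3-even⇔ : ∀ {h i j} → 2 ≤ h → i < h + h → j < h + h →
                     T (hararyAdjℕ 3 (h + h) i j) ⇔
                     (j ≡ modN (h + h) (i + 1) ⊎ j ≡ modN (h + h) (i + (h + h ∸ 1)) ⊎ j ≡ modN (h + h) (i + h))
hararyAdjℕ-3-even⇔ {h} {i} {j} 2≤h i<n j<n = begin
  T (hararyAdjℕ 3 n i j)
    ≡⟨ cong T (hararyAdjℕ-3-even (isEven-double h) i j) ⟩
  T (not (eqᵇ i j) ∧ (evenAdj 2 n i j ∨ oddEvenExtra n i j ∨ oddEvenExtra n j i))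
    ∼⟨ T-symmetrised (evenAdj 2 n i j) (oddEvenExtra n i j) (oddEvenExtra n j i) ⟩
  (i ≢ j × (T (evenAdj 2 n i j) ⊎ T (oddEvenExtra n i j) ⊎ T (oddEvenExtra n j i)))
    ∼⟨ ⇔.refl ×-⇔ (T-evenAdj-2 2≤n i<n j<n ⊎-⇔ ⇔.trans (T-oddEvenExtra ⊎-⇔ T-oddEvenExtra) (halfTurns⇔ 1≤h i<n j<n)) ⟩
  (i ≢ j × ((j ≡ modN n (i + 1) ⊎ j ≡ modN n (i + (n ∸ 1))) ⊎ j ≡ modN n (i + h)))
    ∼⟨ ≢-redundant [ step⇒≢ 2≤n i<n , modN-+-≢ i<n 1≤h (m<m+n h 1≤h) ] ⟩
  ((j ≡ modN n (i + 1) ⊎ j ≡ modN n (i + (n ∸ 1))) ⊎ j ≡ modN n (i + h))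
    ↔⟨ ⊎-assoc 0ℓ _ _ _ ⟩
  (j ≡ modN n (i + 1) ⊎ j ≡ modN n (i + (n ∸ 1)) ⊎ j ≡ modN n (i + h))
    ∎
  where
  open EquationalReasoning {k = equivalence}
  n : ℕ
  n = h + h
  1≤h : 1 ≤ h
  1≤h = ≤-trans (s≤s z≤n) 2≤h
  2≤n : 2 ≤ n
  2≤n = ≤-trans 2≤h (m≤m+n h h)

-- The neighbours of v_i are v_{i+d} (mod n) for the offsets d = 1, n − 1, h; distinct
-- offsets give distinct neighbours.
H-3-even-regular : ∀ h → 2 ≤ h → ∀ u → degree (H 3 (h + h)) u ≡ 3
H-3-even-regular h 2≤h u = weight-neighbours₃ {adj = H 3 (h + h)}
  (neighbours₃-fromℕ (hararyAdjℕ 3 n) refl (shift<n 1<n) (shift<n n∸1<n) (shift<n h<n)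
     (modN-+-distinct 1≢n∸1 1<n n∸1<n) (modN-+-distinct (<⇒≢ 2≤h) 1<n h<n) (modN-+-distinct (≢-sym h≢n∸1) n∸1<n h<n)
     (hararyAdjℕ-3-even⇔ 2≤h i<n))
  (λ _ → 1)
  where
  n : ℕ
  n = h + h
  i : ℕ
  i = toℕ u
  i<n : i < n
  i<n = toℕ<n u
  1≤h : 1 ≤ h
  1≤h = ≤-trans (s≤s z≤n) 2≤h
  1<n : 1 < n
  1<n = ≤-trans 2≤h (m≤m+n h h)
  h<n : h < n
  h<n = m<m+n h 1≤h
  n∸1<n : n ∸ 1 < n
  n∸1<n = ∸-monoʳ-< z<s (≤-trans 1≤h (m≤m+n h h))
  h<n∸1 : h < n ∸ 1
  h<n∸1 = subst (h <_) (sym (+-∸-assoc h 1≤h)) (m<m+n h (m<n⇒0<n∸m 2≤h))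
  1≢n∸1 : 1 ≢ n ∸ 1
  1≢n∸1 = <⇒≢ (<-trans 2≤h h<n∸1)
  h≢n∸1 : h ≢ n ∸ 1
  h≢n∸1 = <⇒≢ h<n∸1
  shift<n : ∀ {d} → d < n → modN n (i + d) < n
  shift<n d<n = modN<n (+-mono-< i<n d<n)

H-3-even-¬distanceMagic : ∀ h → 2 ≤ h → ¬ DistanceMagic (H 3 (h + h))
H-3-even-¬distanceMagic h 2≤h magic =
  ¬2∣1+2* (3 * h + 1) (subst (2 ∣_) (3*[1+2h]≡1+2*[3h+1] h)
    (distanceMagic-regular⇒2∣ {{nonZero}} (H-symmetric 3 (h + h)) (H-3-even-regular h 2≤h) magic))
  where
  nonZero : NonZero (h + h)
  nonZero = >-nonZero (≤-trans (s≤s z≤n) (≤-trans 2≤h (m≤m+n h h)))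
  3*[1+2h]≡1+2*[3h+1] : ∀ h → 3 * suc (h + h) ≡ 1 + 2 * (3 * h + 1)
  3*[1+2h]≡1+2*[3h+1] = solve-∀

-- H_{3,n} for odd n = 2m + 1

isEven-odd : ∀ m → isEven (suc (m + m)) ≡ false
isEven-odd m = cong (λ r → eqᵇ r 0) (trans (cong (_% 2) (odd≡1+m*2 m)) ([m+kn]%n≡m%n 1 m 2))
  where
  odd≡1+m*2 : ∀ m → suc (m + m) ≡ 1 + m * 2
  odd≡1+m*2 = solve-∀

half-odd : ∀ m → (suc (m + m) + 1) / 2 ≡ suc m
half-odd m = trans (cong (_/ 2) (odd+1≡double m)) (half-double (suc m))
  where
  odd+1≡double : ∀ m → suc (m + m) + 1 ≡ suc m + suc m
  odd+1≡double = solve-∀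

hararyAdjℕ-3-odd : ∀ {n} → isEven n ≡ false → ∀ i j →
                   hararyAdjℕ 3 n i j ≡ not (eqᵇ i j) ∧ (evenAdj 2 n i j ∨ oddOddExtra n i j ∨ oddOddExtra n j i)
hararyAdjℕ-3-odd {n} odd i j with isEven n
hararyAdjℕ-3-odd {n} refl i j | false = refl

Chord : ℕ → ℕ → ℕ → Set
Chord m i j = (i ≡ 0 × (j ≡ m ⊎ j ≡ suc m)) ⊎ (1 ≤ i × i < m × j ≡ i + suc m)

T-oddOddExtra : ∀ {m i j} → 1 ≤ m → T (oddOddExtra (suc (m + m)) i j) ⇔ Chord m i j
T-oddOddExtra {m} {i} {j} 1≤m rewrite half-double m | half-odd m =
  ⇔.trans T-∨ (⇔.trans T-∧ (T-eqᵇ ×-⇔ ⇔.trans T-∨ (⇔.trans T-eqᵇ (≡modN⇔≡ m<n) ⊎-⇔ ⇔.trans T-eqᵇ (≡modN⇔≡ (s≤s (m<m+n m 1≤m)))))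
               ⊎-⇔ ⇔.trans T-∧ (T-leᵇ ×-⇔ ⇔.trans T-∧ forward-chord))
  where
  n : ℕ
  n = suc (m + m)
  m<n : m < n
  m<n = s≤s (m≤m+n m m)
  i+suc-m<n : i < m → i + suc m < n
  i+suc-m<n i<m = subst (_< n) (sym (+-suc i m)) (s≤s (+-monoˡ-< m i<m))
  forward-chord : (T (ltᵇ i m) × T (eqᵇ j (modN n (i + suc m)))) ⇔ (i < m × j ≡ i + suc m)
  forward-chord = ⇔.trans (T-ltᵇ ×-⇔ T-eqᵇ)
    (mk⇔ (λ (i<m , e) → i<m , Equivalence.to (≡modN⇔≡ (i+suc-m<n i<m)) e)
         (λ (i<m , e) → i<m , Equivalence.from (≡modN⇔≡ (i+suc-m<n i<m)) e))

chord⇒≢ : ∀ {m i j} → 1 ≤ m → Chord m i j → i ≢ j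
chord⇒≢ 1≤m (inj₁ (refl , inj₁ refl)) = <⇒≢ 1≤m
chord⇒≢ 1≤m (inj₁ (refl , inj₂ refl)) = λ ()
chord⇒≢ 1≤m (inj₂ (_ , _ , refl))     = <⇒≢ (m<m+n _ z<s)

hararyAdjℕ-3-odd⇔ : ∀ {m i j} → 1 ≤ m → i < suc (m + m) → j < suc (m + m) →
                    T (hararyAdjℕ 3 (suc (m + m)) i j) ⇔
                    ((j ≡ modN (suc (m + m)) (i + 1) ⊎ j ≡ modN (suc (m + m)) (i + (m + m))) ⊎ Chord m i j ⊎ Chord m j i)
hararyAdjℕ-3-odd⇔ {m} {i} {j} 1≤m i<n j<n = begin
  T (hararyAdjℕ 3 n i j)
    ≡⟨ cong T (hararyAdjℕ-3-odd (isEven-odd m) i j) ⟩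
  T (not (eqᵇ i j) ∧ (evenAdj 2 n i j ∨ oddOddExtra n i j ∨ oddOddExtra n j i))
    ∼⟨ T-symmetrised (evenAdj 2 n i j) (oddOddExtra n i j) (oddOddExtra n j i) ⟩
  (i ≢ j × (T (evenAdj 2 n i j) ⊎ T (oddOddExtra n i j) ⊎ T (oddOddExtra n j i)))
    ∼⟨ ⇔.refl ×-⇔ (T-evenAdj-2 2≤n i<n j<n ⊎-⇔ (T-oddOddExtra 1≤m ⊎-⇔ T-oddOddExtra 1≤m)) ⟩
  (i ≢ j × ((j ≡ modN n (i + 1) ⊎ j ≡ modN n (i + (m + m))) ⊎ Chord m i j ⊎ Chord m j i))
    ∼⟨ ≢-redundant [ step⇒≢ 2≤n i<n , [ chord⇒≢ 1≤m , ≢-sym ∘ chord⇒≢ 1≤m ] ] ⟩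
  ((j ≡ modN n (i + 1) ⊎ j ≡ modN n (i + (m + m))) ⊎ Chord m i j ⊎ Chord m j i)
    ∎
  where
  open EquationalReasoning {k = equivalence}
  n : ℕ
  n = suc (m + m)
  2≤n : 2 ≤ n
  2≤n = s≤s (≤-trans 1≤m (m≤m+n m m))

hararyAdjℕ-3-odd-1⇔ : ∀ {m j} → 2 ≤ m → j < suc (m + m) →
                      T (hararyAdjℕ 3 (suc (m + m)) 1 j) ⇔ (j ≡ 2 + m ⊎ j ≡ 0 ⊎ j ≡ 2)
hararyAdjℕ-3-odd-1⇔ {m} {j} 2≤m j<n = begin
  T (hararyAdjℕ 3 n 1 j)
    ∼⟨ hararyAdjℕ-3-odd⇔ 1≤m (s≤s (≤-trans 1≤m (m≤m+n m m))) j<n ⟩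
  ((j ≡ modN n 2 ⊎ j ≡ modN n n) ⊎ Chord m 1 j ⊎ Chord m j 1)
    ∼⟨ (≡modN⇔≡ 2<n ⊎-⇔ ≡-congʳ-⇔ (modN-self n)) ⊎-⇔ ⇔.trans (⊎-dropʳ no-chord-to-1) chord-from-1 ⟩
  ((j ≡ 2 ⊎ j ≡ 0) ⊎ j ≡ 2 + m)
    ↔⟨ ⊎-comm _ _ ⟩
  (j ≡ 2 + m ⊎ j ≡ 2 ⊎ j ≡ 0)
    ∼⟨ ⇔.refl ⊎-⇔ ↔⇒⇔ (⊎-comm _ _) ⟩
  (j ≡ 2 + m ⊎ j ≡ 0 ⊎ j ≡ 2)
    ∎
  where
  open EquationalReasoning {k = equivalence}
  n : ℕ
  n = suc (m + m)
  1≤m : 1 ≤ m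
  1≤m = ≤-trans (s≤s z≤n) 2≤m
  2<n : 2 < n
  2<n = s≤s (≤-trans 2≤m (m≤m+n m m))
  chord-from-1 : Chord m 1 j ⇔ j ≡ 2 + m
  chord-from-1 = mk⇔ [ (λ { (() , _) }) , proj₂ ∘ proj₂ ] (λ e → inj₂ (≤-refl , 2≤m , e))
  no-chord-to-1 : ¬ Chord m j 1
  no-chord-to-1 (inj₁ (_ , inj₁ 1≡m))           = <⇒≢ 2≤m 1≡m
  no-chord-to-1 (inj₁ (_ , inj₂ 1≡1+m))         = <⇒≢ 1≤m (suc-injective 1≡1+m)
  no-chord-to-1 (inj₂ (s≤s {n = k} _ , _ , 1≡)) = contradiction (trans (suc-injective 1≡) (+-suc k m)) λ ()

hararyAdjℕ-3-odd-1+m⇔ : ∀ {m j} → 2 ≤ m → j < suc (m + m) →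
                        T (hararyAdjℕ 3 (suc (m + m)) (suc m) j) ⇔ (j ≡ 2 + m ⊎ j ≡ 0 ⊎ j ≡ m)
hararyAdjℕ-3-odd-1+m⇔ {m} {j} 2≤m j<n = begin
  T (hararyAdjℕ 3 n (suc m) j)
    ∼⟨ hararyAdjℕ-3-odd⇔ 1≤m (s≤s (m<m+n m 1≤m)) j<n ⟩
  ((j ≡ modN n (suc m + 1) ⊎ j ≡ modN n (suc m + (m + m))) ⊎ Chord m (suc m) j ⊎ Chord m j (suc m))
    ∼⟨ (≡-congʳ-⇔ next≡2+m ⊎-⇔ ≡-congʳ-⇔ prev≡m) ⊎-⇔ ⇔.trans (⊎-dropˡ no-chord-from-1+m) chord-to-1+m ⟩
  ((j ≡ 2 + m ⊎ j ≡ m) ⊎ j ≡ 0)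
    ↔⟨ ⊎-assoc 0ℓ _ _ _ ⟩
  (j ≡ 2 + m ⊎ j ≡ m ⊎ j ≡ 0)
    ∼⟨ ⇔.refl ⊎-⇔ ↔⇒⇔ (⊎-comm _ _) ⟩
  (j ≡ 2 + m ⊎ j ≡ 0 ⊎ j ≡ m)
    ∎
  where
  open EquationalReasoning {k = equivalence}
  n : ℕ
  n = suc (m + m)
  1≤m : 1 ≤ m
  1≤m = ≤-trans (s≤s z≤n) 2≤m
  1+m+[m+m]≡m+n : ∀ m → suc m + (m + m) ≡ m + suc (m + m)
  1+m+[m+m]≡m+n = solve-∀
  next≡2+m : modN n (suc m + 1) ≡ 2 + m
  next≡2+m = trans (cong (modN n) (+-comm (suc m) 1)) (modN-< (s≤s (+-monoˡ-≤ m 2≤m)))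
  prev≡m : modN n (suc m + (m + m)) ≡ m
  prev≡m = trans (cong (modN n) (1+m+[m+m]≡m+n m)) (trans (modN-≥ (m≤n+m n m)) (m+n∸n≡m m n))
  no-chord-from-1+m : ¬ Chord m (suc m) j
  no-chord-from-1+m (inj₂ (_ , 1+m<m , _)) = <⇒≱ 1+m<m (n≤1+n m)
  chord-to-1+m : Chord m j (suc m) ⇔ j ≡ 0
  chord-to-1+m = mk⇔ [ proj₁ , (λ (_ , _ , e) → +-cancelʳ-≡ (suc m) j 0 (sym e)) ] (λ j≡0 → inj₁ (j≡0 , inj₂ refl))

H-3-odd-¬distanceMagic : ∀ m → 3 ≤ m → ¬ DistanceMagic (H 3 (suc (m + m)))
H-3-odd-¬distanceMagic m 3≤m magic = <⇒≢ 3≤m (fromℕ<-injective 2 m 2<n m<n (distanceMagic-twins magic N₁ N₁₊ₘ))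
  where
  n : ℕ
  n = suc (m + m)
  2≤m : 2 ≤ m
  2≤m = ≤-trans (s≤s (s≤s z≤n)) 3≤m
  0≢m : 0 ≢ m
  0≢m = <⇒≢ (≤-trans (s≤s z≤n) 2≤m)
  0<n : 0 < n
  0<n = z<s
  2<n : 2 < n
  2<n = s≤s (≤-trans 2≤m (m≤m+n m m))
  1<n : 1 < n
  1<n = <⇒≤ 2<n
  m<n : m < n
  m<n = s≤s (m≤m+n m m)
  1+m<n : suc m < n
  1+m<n = s≤s (m<m+n m (≤-trans (s≤s z≤n) 2≤m))
  2+m<n : 2 + m < n
  2+m<n = s≤s (+-monoˡ-≤ m 2≤m)
  N₁ : Neighbours₃ (H 3 n) (fromℕ< 1<n) (fromℕ< 2+m<n) (fromℕ< 0<n) (fromℕ< 2<n)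
  N₁ = neighbours₃-fromℕ (hararyAdjℕ 3 n) (toℕ-fromℕ< 1<n) 2+m<n 0<n 2<n
         (λ ()) (0≢m ∘ sym ∘ suc-injective ∘ suc-injective) (λ ()) (hararyAdjℕ-3-odd-1⇔ 2≤m)
  N₁₊ₘ : Neighbours₃ (H 3 n) (fromℕ< 1+m<n) (fromℕ< 2+m<n) (fromℕ< 0<n) (fromℕ< m<n)
  N₁₊ₘ = neighbours₃-fromℕ (hararyAdjℕ 3 n) (toℕ-fromℕ< 1+m<n) 2+m<n 0<n m<n
           (λ ()) (λ 2+m≡m → 1+n≰n (≤-trans (n≤1+n (suc m)) (≤-reflexive 2+m≡m))) 0≢m (hararyAdjℕ-3-odd-1+m⇔ 2≤m)

H-3-5-distanceMagic : DistanceMagic (H 3 5)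
H-3-5-distanceMagic = ↔⇒⤖ (mk↔ₛ′ σ σ⁻¹ σσ⁻¹ σ⁻¹σ) , 10 , magic
  where
  σ σ⁻¹ : Fin 5 → Fin 5
  σ 0F = 4F
  σ 1F = 0F
  σ 2F = 1F
  σ 3F = 3F
  σ 4F = 2F
  σ⁻¹ 0F = 1F
  σ⁻¹ 1F = 2F
  σ⁻¹ 2F = 4F
  σ⁻¹ 3F = 3F
  σ⁻¹ 4F = 0F
  σσ⁻¹ : ∀ v → σ (σ⁻¹ v) ≡ v
  σσ⁻¹ 0F = refl
  σσ⁻¹ 1F = refl
  σσ⁻¹ 2F = refl
  σσ⁻¹ 3F = refl
  σσ⁻¹ 4F = refl
  σ⁻¹σ : ∀ v → σ⁻¹ (σ v) ≡ v
  σ⁻¹σ 0F = refl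
  σ⁻¹σ 1F = refl
  σ⁻¹σ 2F = refl
  σ⁻¹σ 3F = refl
  σ⁻¹σ 4F = refl
  magic : ∀ u → weight (H 3 5) (suc ∘ toℕ ∘ σ) u ≡ 10
  magic 0F = refl
  magic 1F = refl
  magic 2F = refl
  magic 3F = refl
  magic 4F = refl

even-or-odd : ∀ n → (∃[ h ] n ≡ h + h) ⊎ (∃[ m ] n ≡ suc (m + m))
even-or-odd zero    = inj₁ (0 , refl)
even-or-odd (suc n) with even-or-odd n
... | inj₁ (h , refl) = inj₂ (h , refl)
... | inj₂ (m , refl) = inj₁ (suc m , cong suc (sym (+-suc m m)))

H-3-distanceMagic⇒5 : ∀ n → 4 ≤ n → DistanceMagic (H 3 n) → n ≡ 5
H-3-distanceMagic⇒5 n 4≤n magic with even-or-odd n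
... | inj₁ (0 , refl)               = contradiction 4≤n λ ()
... | inj₁ (1 , refl)               = contradiction 4≤n λ { (s≤s (s≤s ())) }
... | inj₁ (suc (suc h) , refl)     = contradiction magic (H-3-even-¬distanceMagic (2 + h) (s≤s (s≤s z≤n)))
... | inj₂ (0 , refl)               = contradiction 4≤n λ { (s≤s ()) }
... | inj₂ (1 , refl)               = contradiction 4≤n λ { (s≤s (s≤s (s≤s ()))) }
... | inj₂ (2 , refl)               = refl
... | inj₂ (suc (suc (suc m)) , refl) = contradiction magic (H-3-odd-¬distanceMagic (3 + m) (s≤s (s≤s (s≤s z≤n))))

mainTheorem1 : (n : ℕ) → 4 ≤ n → (DistanceMagic (H 3 n) ⇔ n ≡ 5)
mainTheorem1 n 4≤n = mk⇔ (H-3-distanceMagic⇒5 n 4≤n) λ { refl → H-3-5-distanceMagic }
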